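{- Let $\langle A;\cdot,0,\Diamond\rangle$ be a monadic quasi-implication algebra. On $A\setminus\{0\}$ define $x\perp^M_A y$ iff $x\cdot(y\cdot 0)=1$, and $x R^M_A y$ iff $y\cdot\Diamond x=1$. Then for every $x\in A\setminus\{0\}$, \[R^M_A[\{x\}]^{\perp^M_A}=\{y\in A\setminus\{0\}: y\cdot(\Diamond x\cdot 0)=1\}.\]
   Context: A quasi-implication algebra is a magma $\langle A;\cdot\rangle$ satisfying, for all $x,y,z$: (1) $(x\cdot y)\cdot x=x$; (2) $(x\cdot y)\cdot(x\cdot z)=(y\cdot x)\cdot(y\cdot z)$; (3) $((x\cdot y)\cdot(y\cdot x))\cdot x=((y\cdot x)\cdot(x\cdot y))\cdot y$. In any quasi-implication algebra $x\cdot x=y\cdot y$ for all $x,y$, and $1$ denotes this common element. A bounded quasi-implication algebra is a quasi-implication algebra with a distinguished element $0$ such that $0\cdot x=1$ for all $x$. A monadic quasi-implication algebra is an algebra $\langle A;\cdot,0,\Diamond\rangle$ such that $\langle A;\cdot,0\rangle$ is a bounded quasi-implication algebra and $\Diamond\colon A\to A$ satisfies, for all $x,y$: (a) $\Diamond\Diamond x\cdot\Diamond x=1$ and $x\cdot\Diamond x=1$; (b) $\Diamond(\Diamond x\cdot 0)=\Diamond x\cdot 0$ and $\Diamond 0=0$; (c) $\Diamond(((x\cdot 0)\cdot(y\cdot 0))\cdot x)=((\Diamond x\cdot 0)\cdot(\Diamond y\cdot 0))\cdot\Diamond x$. For a relation $R$ on a set $X$ and $U\subseteq X$, $R[U]=\{y\in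 X: uRy\text{ for some }u\in U\}$; for a relation $\perp$ on $X$, $U^{\perp}=\{y\in X: y\perp u\text{ for all }u\in U\}$. -}

module Defs where

open import Level using (Level; suc; _⊔_)
open import Relation.Binary.PropositionalEquality using (_≡_; _≢_)
open import Data.Product using (Σ; _×_; ∃-syntax)

record IsQIA {a} (A : Set a) (_·_ : A → A → A) : Set a where
  field
    qia1 : ∀ x y → (x · y) · x ≡ x
    qia2 : ∀ x y z → (x · y) · (x · z) ≡ (y · x) · (y · z)
    qia3 : ∀ x y → ((x · y) · (y · x)) · x ≡ ((y · x) · (x · y)) · y

-- 1 is the common value of x · x (well defined by the QIA axioms).
one : ∀ {a} {A : Set a} (_·_ : A → A → A) → A → A
one _·_ x = x · x

record MonadicQIA (a : Level) : Set (suc a) where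
  infixl 7 _·_
  field
    Carrier : Set a
    _·_     : Carrier → Carrier → Carrier
    𝟘       : Carrier
    ◇       : Carrier → Carrier
    isQIA   : IsQIA Carrier _·_
  -- 1 := 𝟘 · 𝟘 (equal to x · x for every x in any QIA)
  𝟙 : Carrier
  𝟙 = 𝟘 · 𝟘
  field
    bounded : ∀ x → 𝟘 · x ≡ 𝟙
    ma1 : ∀ x → ◇ (◇ x) · ◇ x ≡ 𝟙
    ma2 : ∀ x → x · ◇ x ≡ 𝟙
    mb1 : ∀ x → ◇ (◇ x · 𝟘) ≡ ◇ x · 𝟘
    mb2 : ◇ 𝟘 ≡ 𝟘
    mc  : ∀ x y → ◇ (((x · 𝟘) · (y · 𝟘)) · x) ≡ ((◇ x · 𝟘) · (◇ y · 𝟘)) · ◇ x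

module Frame {a} (M : MonadicQIA a) where
  open MonadicQIA M

  InX : Carrier → Set a
  InX x = x ≢ 𝟘

  _⊥M_ : Carrier → Carrier → Set a
  x ⊥M y = x · (y · 𝟘) ≡ 𝟙

  RM : Carrier → Carrier → Set a
  RM x y = y · ◇ x ≡ 𝟙

  image : (Carrier → Set a) → Carrier → Set a
  image U y = InX y × ∃[ u ] (U u × RM u y)

  perp : (Carrier → Set a) → Carrier → Set a
  perp U y = InX y × (∀ u → U u → y ⊥M u)

  singleton : Carrier → Carrier → Set a
  singleton x u = InX u × (u ≡ x)

  target : Carrier → Carrier → Set a
  target x y = InX y × (y · (◇ x · 𝟘) ≡ 𝟙)

-- In a bounded quasi-implication algebra x ↦ x · 0 is an order-reversing involution
-- for the order x ≤ y ⇔ x · y = 1.  Since x ≤ ◇x, and ◇x ≠ 0 whenever x ≠ 0, the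
-- element ◇x is itself an R-successor of x, which forces every y in R[{x}]^⊥ to
-- satisfy y ≤ ◇x · 0.  Conversely, every R-successor u of x has u ≤ ◇x, hence
-- ◇x · 0 ≤ u · 0, and y ≤ ◇x · 0 gives y ≤ u · 0 by transitivity.
module Submission where

open import Defs
open import Function.Bundles using (_⇔_; mk⇔)
open import Relation.Binary.PropositionalEquality
open import Data.Product using (_,_)

module QuasiImplicationProperties {a} {A : Set a} {_·_ : A → A → A}
                                  (isQIA : IsQIA A _·_) where
  open IsQIA isQIA
  open ≡-Reasoning

  x·[x·y]≡x·y : ∀ x y → x · (x · y) ≡ x · y
  x·[x·y]≡x·y x y = subst (λ t → t · (x · y) ≡ x · y) (qia1 x y) (qia1 (x · y) x)

  x·[[x·y]·z]≡[x·y]·[x·z] : ∀ x y z → x · ((x · y) · z) ≡ (x · y) · (x · z)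
  x·[[x·y]·z]≡[x·y]·[x·z] x y z = begin
    x · ((x · y) · z)             ≡⟨ cong (_· ((x · y) · z)) (qia1 x y) ⟨
    ((x · y) · x) · ((x · y) · z) ≡⟨ qia2 x (x · y) z ⟨
    (x · (x · y)) · (x · z)       ≡⟨ cong (_· (x · z)) (x·[x·y]≡x·y x y) ⟩
    (x · y) · (x · z)             ∎

  [y·x]·[y·x]≡x·x : ∀ x y → (y · x) · (y · x) ≡ x · x
  [y·x]·[y·x]≡x·x x y = begin
    (y · x) · (y · x)  ≡⟨ qia2 x y x ⟨
    (x · y) · (x · x)  ≡⟨ x·[[x·y]·z]≡[x·y]·[x·z] x y x ⟨
    x · ((x · y) · x)  ≡⟨ cong (x ·_) (qia1 x y) ⟩
    x · x              ∎

  y·[x·x]≡x·x : ∀ x y → y · (x · x) ≡ x · x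
  y·[x·x]≡x·x x y = subst (λ t → y · t ≡ t) ([y·x]·[y·x]≡x·x x y) (begin
    y · ((y · x) · (y · x))  ≡⟨ x·[[x·y]·z]≡[x·y]·[x·z] y x (y · x) ⟩
    (y · x) · (y · (y · x))  ≡⟨ cong ((y · x) ·_) (x·[x·y]≡x·y y x) ⟩
    (y · x) · (y · x)        ∎)

  -- Axiom (3) for the pair x · x, y · y: each side collapses to its last factor.
  x·x≡y·y : ∀ x y → x · x ≡ y · y
  x·x≡y·y x y = begin
    e                          ≡⟨ collapse x y ⟨
    ((e · f) · (f · e)) · e    ≡⟨ qia3 e f ⟩
    ((f · e) · (e · f)) · f    ≡⟨ collapse y x ⟩
    f                          ∎
    where
    e = x · x
    f = y · y
    collapse : ∀ u v → (((u · u) · (v · v)) · ((v · v) · (u · u))) · (u · u) ≡ u · u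
    collapse u v = begin
      (((u · u) · (v · v)) · ((v · v) · (u · u))) · (u · u)
        ≡⟨ cong₂ (λ p q → (p · q) · (u · u)) (y·[x·x]≡x·x v (u · u)) (y·[x·x]≡x·x u (v · v)) ⟩
      ((v · v) · (u · u)) · (u · u)  ≡⟨ cong (_· (u · u)) (y·[x·x]≡x·x u (v · v)) ⟩
      (u · u) · (u · u)              ≡⟨ y·[x·x]≡x·x u (u · u) ⟩
      u · u                          ∎

  -- By x·x≡y·y the unit e · e does not depend on the choice of e.
  module Order (e : A) where

    𝟙 : A
    𝟙 = e · e

    infix 4 _≤_
    _≤_ : A → A → Set a
    x ≤ y = x · y ≡ 𝟙

    x≤x : ∀ x → x ≤ x
    x≤x x = x·x≡y·y x e

    x≤𝟙 : ∀ x → x ≤ 𝟙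
    x≤𝟙 x = y·[x·x]≡x·x e x

    𝟙·x≡x : ∀ x → 𝟙 · x ≡ x
    𝟙·x≡x x = trans (cong (_· x) (sym (x≤x x))) (qia1 x x)

    x≤y⇒x·z≡[y·x]·[y·z] : ∀ {x y} z → x ≤ y → x · z ≡ (y · x) · (y · z)
    x≤y⇒x·z≡[y·x]·[y·z] {x} {y} z x≤y = begin
      x · z              ≡⟨ 𝟙·x≡x (x · z) ⟨
      𝟙 · (x · z)        ≡⟨ cong (_· (x · z)) x≤y ⟨
      (x · y) · (x · z)  ≡⟨ qia2 x y z ⟩
      (y · x) · (y · z)  ∎

    ≤-trans : ∀ {x y z} → x ≤ y → y ≤ z → x ≤ z
    ≤-trans {x} {y} {z} x≤y y≤z = begin
      x · z              ≡⟨ x≤y⇒x·z≡[y·x]·[y·z] z x≤y ⟩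
      (y · x) · (y · z)  ≡⟨ cong ((y · x) ·_) y≤z ⟩
      (y · x) · 𝟙        ≡⟨ x≤𝟙 (y · x) ⟩
      𝟙                  ∎

    x≤y⇒x≤y·x : ∀ {x y} → x ≤ y → x ≤ y · x
    x≤y⇒x≤y·x {x} {y} x≤y = begin
      x · (y · x)              ≡⟨ x≤y⇒x·z≡[y·x]·[y·z] (y · x) x≤y ⟩
      (y · x) · (y · (y · x))  ≡⟨ cong ((y · x) ·_) (x·[x·y]≡x·y y x) ⟩
      (y · x) · (y · x)        ≡⟨ x≤x (y · x) ⟩
      𝟙                        ∎

  module Bounded (𝟘 : A) (bounded : ∀ x → 𝟘 · x ≡ 𝟘 · 𝟘) where
    open Order 𝟘

    [x·𝟘]·𝟘≡x : ∀ x → (x · 𝟘) · 𝟘 ≡ x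
    [x·𝟘]·𝟘≡x x = begin
      (x · 𝟘) · 𝟘                  ≡⟨ cong (_· 𝟘) (𝟙·x≡x (x · 𝟘)) ⟨
      (𝟙 · (x · 𝟘)) · 𝟘            ≡⟨ cong (λ t → (t · (x · 𝟘)) · 𝟘) (bounded x) ⟨
      ((𝟘 · x) · (x · 𝟘)) · 𝟘      ≡⟨ qia3 x 𝟘 ⟨
      ((x · 𝟘) · (𝟘 · x)) · x      ≡⟨ cong (λ t → ((x · 𝟘) · t) · x) (bounded x) ⟩
      ((x · 𝟘) · 𝟙) · x            ≡⟨ cong (_· x) (x≤𝟙 (x · 𝟘)) ⟩
      𝟙 · x                        ≡⟨ 𝟙·x≡x x ⟩
      x                            ∎

    x·𝟘≤x·y : ∀ x y → x · 𝟘 ≤ x · y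
    x·𝟘≤x·y x y = begin
      (x · 𝟘) · (x · y)  ≡⟨ qia2 x 𝟘 y ⟩
      (𝟘 · x) · (𝟘 · y)  ≡⟨ cong₂ _·_ (bounded x) (bounded y) ⟩
      𝟙 · 𝟙              ≡⟨ x≤x 𝟙 ⟩
      𝟙                  ∎

    ·𝟘-antitone : ∀ {x y} → x ≤ y → y · 𝟘 ≤ x · 𝟘
    ·𝟘-antitone {x} {y} x≤y =
      subst (λ t → y · 𝟘 ≤ t) (sym (x≤y⇒x·z≡[y·x]·[y·z] 𝟘 x≤y))
            (x≤y⇒x≤y·x (x·𝟘≤x·y y x))

    x·𝟘≡𝟙⇒x≡𝟘 : ∀ {x} → x · 𝟘 ≡ 𝟙 → x ≡ 𝟘
    x·𝟘≡𝟙⇒x≡𝟘 {x} x·𝟘≡𝟙 = begin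
      x            ≡⟨ [x·𝟘]·𝟘≡x x ⟨
      (x · 𝟘) · 𝟘  ≡⟨ cong (_· 𝟘) x·𝟘≡𝟙 ⟩
      𝟙 · 𝟘        ≡⟨ 𝟙·x≡x 𝟘 ⟩
      𝟘            ∎

module MonadicProperties {a} (M : MonadicQIA a) where
  open MonadicQIA M
  open QuasiImplicationProperties isQIA
  open Order 𝟘 public
  open Bounded 𝟘 bounded public

  ◇-nonzero : ∀ {x} → x ≢ 𝟘 → ◇ x ≢ 𝟘
  ◇-nonzero {x} x≢𝟘 ◇x≡𝟘 = x≢𝟘 (x·𝟘≡𝟙⇒x≡𝟘 (subst (λ t → x ≤ t) ◇x≡𝟘 (ma2 x)))

lemma5p5 : ∀ {a} (M : MonadicQIA a) (x : MonadicQIA.Carrier M) →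
    Frame.InX M x → ∀ y →
      Frame.perp M (Frame.image M (Frame.singleton M x)) y ⇔ Frame.target M x y
lemma5p5 M x x≢𝟘 y = mk⇔ to from
  where
  open MonadicQIA M
  open MonadicProperties M
  open Frame M

  ◇x∈R[x] : image (singleton x) (◇ x)
  ◇x∈R[x] = ◇-nonzero x≢𝟘 , x , (x≢𝟘 , refl) , x≤x (◇ x)

  to : perp (image (singleton x)) y → target x y
  to (y≢𝟘 , y⊥R[x]) = y≢𝟘 , y⊥R[x] (◇ x) ◇x∈R[x]

  from : target x y → perp (image (singleton x)) y
  from (y≢𝟘 , y≤◇x·𝟘) = y≢𝟘 , λ { u (_ , _ , (_ , refl) , u≤◇x) →
    ≤-trans y≤◇x·𝟘 (·𝟘-antitone u≤◇x) }
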